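{- For all $d\in\mathbb{N}$ there is a constant $c_d$ depending only on $d$ such that for every set of edges $S$ with $|S|\leq\sqrt{n}$ and all vertices $v,w\in[n]$ with $(v,w)\notin S$, we have $\Pr_{G\leftarrow\mathbf{G}(n,d)\cap S}[(v,w)\in G]\leq c_d/n$.
   Context: $\mathbf{G}(n,d)$ is the uniform distribution over $d$-regular graphs on vertex set $[n]$ (for $d$ odd, $n$ is even). For a set of edges $S$, $\mathbf{G}(n,d)\cap S$ is the uniform distribution over $d$-regular graphs on $[n]$ containing all edges of $S$ (considered when this set of graphs is nonempty). -}

module Defs where

open import Data.Nat using (ℕ; zero; suc; _+_; _*_; _<ᵇ_)
open import Data.Bool using (Bool; true; false; _∧_; if_then_else_; not)
open import Data.Fin using (Fin; zero; suc; toℕ)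
open import Data.List using (List; []; _∷_; map; concatMap; length; filter; allFin)
open import Data.Bool.ListAction using (and)
open import Data.Nat.ListAction using (sum)
open import Relation.Binary.PropositionalEquality using (_≡_)
open import Relation.Nullary.Decidable using (does)
open import Data.Nat using (_≟_)
open import Data.Bool using () renaming (_≟_ to _≟ᵇ_)

all : {A : Set} → (A → Bool) → List A → Bool
all p xs = and (map p xs)

-- A (possible) graph on vertex set [n] = Fin n, given by its adjacency
-- function.  Simple graphs correspond exactly to the symmetric,
-- irreflexive adjacency functions (see isSimple).
Graph : ℕ → Set
Graph n = Fin n → Fin n → Bool

funs : {A : Set} (n : ℕ) → List A → List (Fin n → A)
funs zero    xs = (λ ()) ∷ []
funs (suc n) xs =
  concatMap (λ a → map (λ f → λ { zero → a ; (suc i) → f i }) (funs n xs)) xs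

allGraphs : (n : ℕ) → List (Graph n)
allGraphs n = funs n (funs n (true ∷ false ∷ []))

isSimple : {n : ℕ} → Graph n → Bool
isSimple {n} G =
  all (λ i → not (G i i) ∧ all (λ j → does (G i j ≟ᵇ G j i)) (allFin n)) (allFin n)

deg : {n : ℕ} → Graph n → Fin n → ℕ
deg {n} G i = sum (map (λ j → if G i j then 1 else 0) (allFin n))

isRegular : {n : ℕ} → ℕ → Graph n → Bool
isRegular {n} d G = all (λ i → does (deg G i ≟ d)) (allFin n)

contains : {n : ℕ} → Graph n → Graph n → Bool
contains {n} G S =
  all (λ i → all (λ j → if S i j then G i j else true) (allFin n)) (allFin n)

edgeCount : {n : ℕ} → Graph n → ℕ
edgeCount {n} S =
  sum (concatMap (λ i → map (λ j → if (toℕ i <ᵇ toℕ j) ∧ S i j then 1 else 0)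
                            (allFin n))
                 (allFin n))

countRegContaining : (n d : ℕ) → Graph n → ℕ
countRegContaining n d S =
  length (filter (λ G → ((isSimple G ∧ isRegular d G ∧ contains G S) ≟ᵇ true))
                 (allGraphs n))

countRegContainingEdge : (n d : ℕ) → Graph n → Fin n → Fin n → ℕ
countRegContainingEdge n d S v w =
  length (filter (λ G → ((isSimple G ∧ isRegular d G ∧ contains G S ∧ G v w) ≟ᵇ true))
                 (allGraphs n))

-- Switching argument.  Let G be a simple d-regular graph containing S and the edge vw.
-- For an edge xy of G outside S with x, y ∉ {v, w}, vx ∉ G and wy ∉ G, replacing vw, xy
-- by vx, wy yields again a simple d-regular graph H ⊇ S, and G is recovered from H and
-- (x, y).  All but at most 2(d + 2)d + 2|S| of the n·d ordered edges xy of G qualify, so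
-- once n ≥ N = 64 + 8(d + 2)d (and |S|² ≤ n) every such G admits at least n/2
-- switchings, while each H arises from at most d² of them (x must be a neighbour of v
-- and y one of w in H).  Double counting gives n·#(G ∋ vw) ≤ 2d²·#G; for n < N the
-- trivial bound #(G ∋ vw) ≤ #G suffices.

module Submission where

open import Defs
open import Data.Nat using (ℕ; zero; suc; _+_; _*_; _≤_; _<ᵇ_; z≤n; s≤s)
open import Data.Nat.Properties hiding (_≟_)
open import Data.Nat.ListAction using (sum)
open import Data.Bool.ListAction using (and)
open import Data.Nat.ListAction.Properties using (sum-++)
open import Data.Nat.Solver using (module +-*-Solver)
open import Algebra.Properties.CommutativeSemigroup +-commutativeSemigroup
  using () renaming (interchange to +-interchange)
open import Data.Bool using (Bool; true; false; _∧_; _∨_; not; if_then_else_)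
open import Data.Bool.Properties
  using (T-≡; ∧-assoc; ∧-comm; ∨-comm; ∧-zeroʳ; ∨-zeroʳ; ∧-conicalˡ; ∧-conicalʳ; ∨-conicalˡ; ∨-conicalʳ;
         ¬-not; not-injective)
open import Data.Fin using (Fin; zero; suc; toℕ)
open import Data.Fin.Properties using (_≟_; toℕ-injective)
open import Data.List using (List; []; _∷_; map; concatMap; length; filter; allFin)
open import Data.List.Properties using (map-tabulate; length-tabulate; map-concatMap)
open import Data.List.Membership.Propositional using (_∈_)
open import Data.List.Membership.Propositional.Properties using (∈-allFin)
open import Data.List.Relation.Unary.Any using (here; there)
open import Data.Product using (∃; _×_; _,_; proj₁; proj₂)
open import Data.Sum using (_⊎_; inj₁; inj₂)
open import Data.Empty using (⊥; ⊥-elim)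
open import Relation.Binary.PropositionalEquality
open import Relation.Nullary using (Dec; _because_; ¬_; invert)
open import Relation.Nullary.Decidable using (does; dec-true)
open import Function using (_∘_; id; Equivalence)
open import Relation.Binary.Definitions using (tri<; tri≈; tri>)
import Data.Bool as Bool
import Data.Nat as ℕ

private
  variable
    A B : Set

-- Indicators and finite sums

does-true⇒ : ∀ {P : Set} (p? : Dec P) → does p? ≡ true → P
does-true⇒ (true because [p]) _ = invert [p]

does-false⇒ : ∀ {P : Set} (p? : Dec P) → does p? ≡ false → ¬ P
does-false⇒ (false because [¬p]) _ = invert [¬p]

∧-true⁻ : ∀ {a b} → a ∧ b ≡ true → a ≡ true × b ≡ true
∧-true⁻ {a} {b} e = ∧-conicalˡ a b e , ∧-conicalʳ a b e

∨-false⁻ : ∀ {a b} → a ∨ b ≡ false → a ≡ false × b ≡ false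
∨-false⁻ {a} {b} e = ∨-conicalˡ a b e , ∨-conicalʳ a b e

⟦_⟧ : Bool → ℕ
⟦ b ⟧ = if b then 1 else 0

⟦∧⟧ : ∀ a b → ⟦ a ∧ b ⟧ ≡ ⟦ a ⟧ * ⟦ b ⟧
⟦∧⟧ true  true  = refl
⟦∧⟧ true  false = refl
⟦∧⟧ false b     = refl

⟦∧⟧-≤ˡ : ∀ a b → ⟦ a ∧ b ⟧ ≤ ⟦ a ⟧
⟦∧⟧-≤ˡ true  true  = ≤-refl
⟦∧⟧-≤ˡ true  false = z≤n
⟦∧⟧-≤ˡ false b     = z≤n

⟦∨⟧-≤ : ∀ a b → ⟦ a ∨ b ⟧ ≤ ⟦ a ⟧ + ⟦ b ⟧
⟦∨⟧-≤ true  b = s≤s z≤n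
⟦∨⟧-≤ false b = ≤-refl

⟦∨⟧-disjoint : ∀ a b → (a ≡ true → b ≡ true → ⊥) → ⟦ a ∨ b ⟧ ≡ ⟦ a ⟧ + ⟦ b ⟧
⟦∨⟧-disjoint true  true  h = ⊥-elim (h refl refl)
⟦∨⟧-disjoint true  false h = refl
⟦∨⟧-disjoint false b     h = refl

⟦⟧*⟦⟧-mono : ∀ p e q e′ → (p ≡ true → e ≡ true → q ≡ true × e′ ≡ true) →
             ⟦ p ⟧ * ⟦ e ⟧ ≤ ⟦ q ⟧ * ⟦ e′ ⟧
⟦⟧*⟦⟧-mono true  true  q e′ h with h refl refl
... | refl , refl = ≤-refl
⟦⟧*⟦⟧-mono true  false q e′ h = z≤n
⟦⟧*⟦⟧-mono false e     q e′ h = z≤n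

∑ : List A → (A → ℕ) → ℕ
∑ xs f = sum (map f xs)

syntax ∑ xs (λ x → e) = ∑[ x ∈ xs ] e

∑-cong : ∀ (xs : List A) {f g : A → ℕ} → (∀ x → f x ≡ g x) → ∑ xs f ≡ ∑ xs g
∑-cong []       eq = refl
∑-cong (x ∷ xs) eq = cong₂ _+_ (eq x) (∑-cong xs eq)

∑-mono : ∀ (xs : List A) {f g : A → ℕ} → (∀ x → f x ≤ g x) → ∑ xs f ≤ ∑ xs g
∑-mono []       le = z≤n
∑-mono (x ∷ xs) le = +-mono-≤ (le x) (∑-mono xs le)

∑-zero : ∀ (xs : List A) → ∑[ x ∈ xs ] 0 ≡ 0
∑-zero []       = refl
∑-zero (x ∷ xs) = ∑-zero xs

∑-const : ∀ (xs : List A) c → ∑[ x ∈ xs ] c ≡ length xs * c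
∑-const []       c = refl
∑-const (x ∷ xs) c = cong (c +_) (∑-const xs c)

∑-+ : ∀ (xs : List A) (f g : A → ℕ) → ∑[ x ∈ xs ] (f x + g x) ≡ ∑ xs f + ∑ xs g
∑-+ []       f g = refl
∑-+ (x ∷ xs) f g =
  trans (cong (f x + g x +_) (∑-+ xs f g)) (+-interchange (f x) (g x) (∑ xs f) (∑ xs g))

∑-*ˡ : ∀ (xs : List A) c (f : A → ℕ) → ∑[ x ∈ xs ] (c * f x) ≡ c * ∑ xs f
∑-*ˡ []       c f = sym (*-zeroʳ c)
∑-*ˡ (x ∷ xs) c f = trans (cong (c * f x +_) (∑-*ˡ xs c f)) (sym (*-distribˡ-+ c (f x) _))

∑-*ʳ : ∀ (xs : List A) c (f : A → ℕ) → ∑[ x ∈ xs ] (f x * c) ≡ ∑ xs f * c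
∑-*ʳ xs c f = trans (∑-cong xs (λ x → *-comm (f x) c)) (trans (∑-*ˡ xs c f) (*-comm c _))

∑-swap : ∀ (xs : List A) (ys : List B) (f : A → B → ℕ) →
         ∑[ x ∈ xs ] ∑ ys (f x) ≡ ∑[ y ∈ ys ] ∑[ x ∈ xs ] f x y
∑-swap []       ys f = sym (∑-zero ys)
∑-swap (x ∷ xs) ys f =
  trans (cong (∑ ys (f x) +_) (∑-swap xs ys f)) (sym (∑-+ ys (f x) _))

∑-*-∑ : ∀ (xs : List A) (ys : List B) (f : A → ℕ) (g : B → ℕ) →
        ∑[ x ∈ xs ] ∑[ y ∈ ys ] (f x * g y) ≡ ∑ xs f * ∑ ys g
∑-*-∑ xs ys f g = trans (∑-cong xs (λ x → ∑-*ˡ ys (f x) g)) (∑-*ʳ xs (∑ ys g) f)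

sum-concatMap : ∀ (g : A → List ℕ) (xs : List A) → sum (concatMap g xs) ≡ ∑[ x ∈ xs ] sum (g x)
sum-concatMap g []       = refl
sum-concatMap g (x ∷ xs) = trans (sum-++ (g x) _) (cong (sum (g x) +_) (sum-concatMap g xs))

∑-concatMap : ∀ (g : A → List B) (xs : List A) (f : B → ℕ) →
              ∑ (concatMap g xs) f ≡ ∑[ x ∈ xs ] ∑ (g x) f
∑-concatMap g xs f = trans (cong sum (map-concatMap f g xs)) (sum-concatMap (map f ∘ g) xs)

∑-map : ∀ (h : A → B) (xs : List A) (f : B → ℕ) → ∑ (map h xs) f ≡ ∑ xs (f ∘ h)
∑-map h []       f = refl
∑-map h (x ∷ xs) f = cong (f (h x) +_) (∑-map h xs f)

term-≤-∑ : ∀ (xs : List A) f {x} → x ∈ xs → f x ≤ ∑ xs f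
term-≤-∑ (y ∷ xs) f (here refl) = m≤m+n (f y) _
term-≤-∑ (y ∷ xs) f (there x∈) = ≤-trans (term-≤-∑ xs f x∈) (m≤n+m _ (f y))

length-filter : ∀ (xs : List A) (p : A → Bool) →
                length (filter (λ x → p x Bool.≟ true) xs) ≡ ∑[ x ∈ xs ] ⟦ p x ⟧
length-filter []       p = refl
length-filter (x ∷ xs) p with p x
... | true  = cong suc (length-filter xs p)
... | false = length-filter xs p

all-sound : ∀ (p : A → Bool) xs → all p xs ≡ true → ∀ {x} → x ∈ xs → p x ≡ true
all-sound p (y ∷ xs) e (here refl) = proj₁ (∧-true⁻ e)
all-sound p (y ∷ xs) e (there x∈)  = all-sound p xs (proj₂ (∧-true⁻ e)) x∈

all-complete : ∀ (p : A → Bool) xs → (∀ x → p x ≡ true) → all p xs ≡ true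
all-complete p []       h = refl
all-complete p (x ∷ xs) h rewrite h x = all-complete p xs h

-- Graphs are functions, so equality of elements is only available as a Boolean pointwise
-- test; "every element occurs exactly once" is therefore relative to such a test.
Enumerates : List A → (A → A → Bool) → Set
Enumerates xs _==_ = ∀ a → ∑[ x ∈ xs ] ⟦ x == a ⟧ ≡ 1

count-≤-via-injection :
  ∀ (xs : List A) (ys : List B) {_=A_ : A → A → Bool} {_=B_ : B → B → Bool} →
  Enumerates xs _=A_ → Enumerates ys _=B_ →
  ∀ (P : A → Bool) (Q : B → Bool) (f : A → B) (g : B → A) →
  (∀ a b → P a ≡ true → b =B f a ≡ true → Q b ≡ true × a =A g b ≡ true) →
  ∑[ a ∈ xs ] ⟦ P a ⟧ ≤ ∑[ b ∈ ys ] ⟦ Q b ⟧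
count-≤-via-injection xs ys {_=A_} {_=B_} enum-xs enum-ys P Q f g inj = begin
  ∑[ a ∈ xs ] ⟦ P a ⟧
    ≡⟨ ∑-cong xs (λ a → times-one (⟦ P a ⟧) (enum-ys (f a))) ⟨
  ∑[ a ∈ xs ] (⟦ P a ⟧ * ∑[ b ∈ ys ] ⟦ b =B f a ⟧)
    ≡⟨ ∑-cong xs (λ a → ∑-*ˡ ys ⟦ P a ⟧ _) ⟨
  ∑[ a ∈ xs ] ∑[ b ∈ ys ] (⟦ P a ⟧ * ⟦ b =B f a ⟧)
    ≤⟨ ∑-mono xs (λ a → ∑-mono ys (λ b → ⟦⟧*⟦⟧-mono (P a) _ (Q b) _ (inj a b))) ⟩
  ∑[ a ∈ xs ] ∑[ b ∈ ys ] (⟦ Q b ⟧ * ⟦ a =A g b ⟧)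
    ≡⟨ ∑-swap xs ys _ ⟩
  ∑[ b ∈ ys ] ∑[ a ∈ xs ] (⟦ Q b ⟧ * ⟦ a =A g b ⟧)
    ≡⟨ ∑-cong ys (λ b → trans (∑-*ˡ xs ⟦ Q b ⟧ _) (times-one ⟦ Q b ⟧ (enum-xs (g b)))) ⟩
  ∑[ b ∈ ys ] ⟦ Q b ⟧ ∎
  where
  open ≤-Reasoning
  times-one : ∀ m {k} → k ≡ 1 → m * k ≡ m
  times-one m refl = *-identityʳ m

map-allFin-suc : ∀ n (f : Fin (suc n) → A) →
                 map f (allFin (suc n)) ≡ f zero ∷ map (f ∘ suc) (allFin n)
map-allFin-suc n f = cong (f zero ∷_) (trans (map-tabulate suc f) (sym (map-tabulate id (f ∘ suc))))

∑-allFin-suc : ∀ n (f : Fin (suc n) → ℕ) → ∑ (allFin (suc n)) f ≡ f zero + ∑ (allFin n) (f ∘ suc)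
∑-allFin-suc n f = cong sum (map-allFin-suc n f)

∑-allFin-const : ∀ n c → ∑[ i ∈ allFin n ] c ≡ n * c
∑-allFin-const n c = trans (∑-const (allFin n) c) (cong (_* c) (length-tabulate {n = n} id))

_=ᶠ_ : ∀ {n} → Fin n → Fin n → Bool
i =ᶠ j = does (i ≟ j)

∑-allFin-=ᶠ : ∀ n (b : Fin n) → ∑[ i ∈ allFin n ] ⟦ i =ᶠ b ⟧ ≡ 1
∑-allFin-=ᶠ (suc n) zero    =
  trans (∑-allFin-suc n (λ i → ⟦ i =ᶠ zero ⟧)) (cong suc (∑-zero (allFin n)))
∑-allFin-=ᶠ (suc n) (suc b) =
  trans (∑-allFin-suc n (λ i → ⟦ i =ᶠ suc b ⟧)) (∑-allFin-=ᶠ n b)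

allFin-sound : ∀ {n} (p : Fin n → Bool) → all p (allFin n) ≡ true → ∀ i → p i ≡ true
allFin-sound p e i = all-sound p _ e (∈-allFin i)

∑² : ∀ {n} → (Fin n → Fin n → ℕ) → ℕ
∑² {n} f = ∑[ x ∈ allFin n ] ∑[ y ∈ allFin n ] f x y

syntax ∑² (λ x y → e) = ∑²[ x , y ] e

module _ {n : ℕ} where

  ∑²-mono : ∀ {f g : Fin n → Fin n → ℕ} → (∀ x y → f x y ≤ g x y) → ∑² f ≤ ∑² g
  ∑²-mono le = ∑-mono (allFin n) λ x → ∑-mono (allFin n) (le x)

  ∑²-+ : ∀ (f g : Fin n → Fin n → ℕ) → ∑²[ x , y ] (f x y + g x y) ≡ ∑² f + ∑² g
  ∑²-+ f g = trans (∑-cong (allFin n) λ x → ∑-+ (allFin n) (f x) (g x)) (∑-+ (allFin n) _ _)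

  ∑²-transpose : ∀ (f : Fin n → Fin n → ℕ) → ∑²[ x , y ] f x y ≡ ∑²[ x , y ] f y x
  ∑²-transpose f = ∑-swap (allFin n) (allFin n) f

  ∑-∑²-swap : ∀ (xs : List A) (f : A → Fin n → Fin n → ℕ) →
              ∑[ a ∈ xs ] ∑² (f a) ≡ ∑²[ x , y ] ∑[ a ∈ xs ] f a x y
  ∑-∑²-swap xs f =
    trans (∑-swap xs (allFin n) _) (∑-cong (allFin n) λ x → ∑-swap xs (allFin n) (λ a → f a x))

  ∑²-*ˡ : ∀ c (f : Fin n → Fin n → ℕ) → ∑²[ x , y ] (c * f x y) ≡ c * ∑² f
  ∑²-*ˡ c f = trans (∑-cong (allFin n) λ x → ∑-*ˡ (allFin n) c (f x)) (∑-*ˡ (allFin n) c _)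

  ∑²-⟦∧⟧ : ∀ b (p : Fin n → Fin n → Bool) → ∑²[ x , y ] ⟦ b ∧ p x y ⟧ ≡ ⟦ b ⟧ * ∑²[ x , y ] ⟦ p x y ⟧
  ∑²-⟦∧⟧ b p = trans (∑-cong (allFin n) λ x → ∑-cong (allFin n) λ y → ⟦∧⟧ b (p x y))
                     (∑²-*ˡ ⟦ b ⟧ (λ x y → ⟦ p x y ⟧))

-- Enumerating graphs

pointwise : ∀ {n} → (A → A → Bool) → (Fin n → A) → (Fin n → A) → Bool
pointwise {n = n} _==_ f g = all (λ i → f i == g i) (allFin n)

funs-enumerates : ∀ n (xs : List A) _==_ → Enumerates xs _==_ →
                  Enumerates (funs n xs) (pointwise _==_)
funs-enumerates zero    xs _==_ enum f = refl
funs-enumerates (suc n) xs _==_ enum f = begin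
  ∑[ g ∈ funs (suc n) xs ] ⟦ pointwise _==_ g f ⟧
    ≡⟨ trans (∑-concatMap _ xs _) (∑-cong xs λ a → trans (∑-map _ (funs n xs) _)
         (∑-cong (funs n xs) λ g → cong (λ bs → ⟦ and bs ⟧) (map-allFin-suc n _))) ⟩
  ∑[ a ∈ xs ] ∑[ g ∈ funs n xs ] ⟦ (a == f zero) ∧ pointwise _==_ g (f ∘ suc) ⟧
    ≡⟨ ∑-cong xs (λ a → trans (∑-cong (funs n xs) λ g → ⟦∧⟧ (a == f zero) _)
                              (∑-*ˡ (funs n xs) ⟦ a == f zero ⟧ (λ g → ⟦ pointwise _==_ g (f ∘ suc) ⟧))) ⟩
  ∑[ a ∈ xs ] (⟦ a == f zero ⟧ * ∑[ g ∈ funs n xs ] ⟦ pointwise _==_ g (f ∘ suc) ⟧)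
    ≡⟨ ∑-cong xs (λ a → cong (⟦ a == f zero ⟧ *_) (funs-enumerates n xs _==_ enum (f ∘ suc))) ⟩
  ∑[ a ∈ xs ] (⟦ a == f zero ⟧ * 1)
    ≡⟨ trans (∑-cong xs λ a → *-identityʳ _) (enum (f zero)) ⟩
  1 ∎
  where open ≡-Reasoning

_==ᵇ_ : Bool → Bool → Bool
a ==ᵇ b = does (a Bool.≟ b)

_==ᴳ_ : ∀ {n} → Graph n → Graph n → Bool
_==ᴳ_ = pointwise (pointwise _==ᵇ_)

allGraphs-enumerates : ∀ n → Enumerates (allGraphs n) _==ᴳ_
allGraphs-enumerates n =
  funs-enumerates n _ (pointwise _==ᵇ_) (funs-enumerates n _ _==ᵇ_ λ { true → refl ; false → refl })

module _ {n : ℕ} where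

  _≐_ : Graph n → Graph n → Set
  G ≐ H = ∀ i j → G i j ≡ H i j

  ==ᴳ-sound : ∀ {G H : Graph n} → G ==ᴳ H ≡ true → G ≐ H
  ==ᴳ-sound {G} {H} e i j = does-true⇒ (G i j Bool.≟ H i j) (allFin-sound _ (allFin-sound _ e i) j)

  ==ᴳ-complete : ∀ {G H : Graph n} → G ≐ H → G ==ᴳ H ≡ true
  ==ᴳ-complete {G} {H} h =
    all-complete _ (allFin n) λ i → all-complete (λ j → G i j ==ᵇ H i j) (allFin n) λ j →
      dec-true (G i j Bool.≟ H i j) (h i j)

module _ {n : ℕ} where

  Symmetric : Graph n → Set
  Symmetric G = ∀ i j → G i j ≡ G j i

  Irreflexive : Graph n → Set
  Irreflexive G = ∀ i → G i i ≡ false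

  infix 4 _⊆_
  _⊆_ : Graph n → Graph n → Set
  A ⊆ B = ∀ i j → A i j ≡ true → B i j ≡ true

  record RegularContaining (d : ℕ) (S G : Graph n) : Set where
    field
      symmetric   : Symmetric G
      irreflexive : Irreflexive G
      regular     : ∀ i → deg G i ≡ d
      contains-S  : S ⊆ G

  regContaining : ℕ → Graph n → Graph n → Bool
  regContaining d S G = isSimple G ∧ isRegular d G ∧ contains G S

  isSimple-sound : ∀ {G : Graph n} → isSimple G ≡ true → Symmetric G × Irreflexive G
  isSimple-sound {G} e =
    (λ i j → does-true⇒ (G i j Bool.≟ G j i) (allFin-sound _ (proj₂ (loops i)) j)) ,
    (λ i → not-injective (proj₁ (loops i)))
    where
    loops : ∀ i → not (G i i) ≡ true × all (λ j → does (G i j Bool.≟ G j i)) (allFin n) ≡ true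
    loops i = ∧-true⁻ (allFin-sound _ e i)

  regContaining-sound : ∀ {d} {S G : Graph n} → regContaining d S G ≡ true → RegularContaining d S G
  regContaining-sound {d} {S} {G} e = record
    { symmetric   = proj₁ (isSimple-sound simple)
    ; irreflexive = proj₂ (isSimple-sound {G} simple)
    ; regular     = λ i → does-true⇒ (deg G i ℕ.≟ d) (allFin-sound _ regular i)
    ; contains-S  = λ i j Sij → trans (sym (cong (if_then G i j else true) Sij))
                                      (allFin-sound _ (allFin-sound _ containsS i) j)
    }
    where
    simple : isSimple G ≡ true
    simple = proj₁ (∧-true⁻ {isSimple G} {isRegular d G ∧ contains G S} e)
    regular : isRegular d G ≡ true
    regular = proj₁ (∧-true⁻ {isRegular d G} (proj₂ (∧-true⁻ {isSimple G} e)))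
    containsS : contains G S ≡ true
    containsS = proj₂ (∧-true⁻ {isRegular d G} (proj₂ (∧-true⁻ {isSimple G} e)))

  regContaining-complete : ∀ {d} {S G : Graph n} → RegularContaining d S G →
                           regContaining d S G ≡ true
  regContaining-complete {d} {S} {G} RC = cong₂ _∧_ simple (cong₂ _∧_ regular′ containsS)
    where
    open RegularContaining RC
    simple : isSimple G ≡ true
    simple = all-complete _ (allFin n) λ i → cong₂ _∧_ (cong not (irreflexive i))
      (all-complete _ (allFin n) λ j → dec-true (G i j Bool.≟ G j i) (symmetric i j))
    regular′ : isRegular d G ≡ true
    regular′ = all-complete _ (allFin n) λ i → dec-true (deg G i ℕ.≟ d) (regular i)
    guarded : ∀ s {g} → (s ≡ true → g ≡ true) → (if s then g else true) ≡ true
    guarded true  h = h refl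
    guarded false h = refl
    containsS : contains G S ≡ true
    containsS = all-complete _ (allFin n) λ i → all-complete _ (allFin n) λ j →
      guarded (S i j) (contains-S i j)

  countRegContaining≡ : ∀ d (S : Graph n) →
    countRegContaining n d S ≡ ∑[ G ∈ allGraphs n ] ⟦ regContaining d S G ⟧
  countRegContaining≡ d S = length-filter (allGraphs n) (regContaining d S)

  countRegContainingEdge≡ : ∀ d (S : Graph n) v w →
    countRegContainingEdge n d S v w ≡ ∑[ G ∈ allGraphs n ] ⟦ regContaining d S G ∧ G v w ⟧
  countRegContainingEdge≡ d S v w =
    trans (length-filter (allGraphs n) (λ G → isSimple G ∧ isRegular d G ∧ contains G S ∧ G v w))
          (∑-cong (allGraphs n) λ G →
             cong ⟦_⟧ (reassociate (isSimple G) (isRegular d G) (contains G S) (G v w)))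
    where
    reassociate : ∀ a b c e → a ∧ b ∧ c ∧ e ≡ (a ∧ b ∧ c) ∧ e
    reassociate a b c e = sym (trans (∧-assoc a (b ∧ c) e) (cong (a ∧_) (∧-assoc b c e)))

  deg-cong : ∀ {G H : Graph n} → G ≐ H → ∀ i → deg G i ≡ deg H i
  deg-cong G≐H i = ∑-cong (allFin n) λ j → cong ⟦_⟧ (G≐H i j)

  RegularContaining-resp : ∀ {d} {S G H : Graph n} → G ≐ H →
                           RegularContaining d S G → RegularContaining d S H
  RegularContaining-resp {G = G} {H} G≐H RC = record
    { symmetric   = λ i j → trans (sym (G≐H i j)) (trans (symmetric i j) (G≐H j i))
    ; irreflexive = λ i → trans (sym (G≐H i i)) (irreflexive i)
    ; regular     = λ i → trans (sym (deg-cong G≐H i)) (regular i)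
    ; contains-S  = λ i j Sij → trans (sym (G≐H i j)) (contains-S i j Sij)
    }
    where open RegularContaining RC

-- Edges and switchings

module _ {n : ℕ} where

  Disjoint : Graph n → Graph n → Set
  Disjoint A B = ∀ i j → A i j ≡ true → B i j ≡ true → ⊥

  Disjoint-sym : ∀ {A B : Graph n} → Disjoint A B → Disjoint B A
  Disjoint-sym A∩B i j Bij Aij = A∩B i j Aij Bij

  edge : Fin n → Fin n → Graph n
  edge a b i j = (i =ᶠ a ∧ j =ᶠ b) ∨ (i =ᶠ b ∧ j =ᶠ a)

  _∪_ : Graph n → Graph n → Graph n
  (A ∪ B) i j = A i j ∨ B i j

  ∪-symmetric : ∀ {A B : Graph n} → Symmetric A → Symmetric B → Symmetric (A ∪ B)
  ∪-symmetric sym-A sym-B i j = cong₂ _∨_ (sym-A i j) (sym-B i j)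

  ∪-irreflexive : ∀ {A B : Graph n} → Irreflexive A → Irreflexive B → Irreflexive (A ∪ B)
  ∪-irreflexive irr-A irr-B i = cong₂ _∨_ (irr-A i) (irr-B i)

  =ᶠ-refl : ∀ (i : Fin n) → i =ᶠ i ≡ true
  =ᶠ-refl i = dec-true (i ≟ i) refl

  edge-sound : ∀ {a b i j} → edge a b i j ≡ true → (i ≡ a × j ≡ b) ⊎ (i ≡ b × j ≡ a)
  edge-sound {a} {b} {i} {j} e with i =ᶠ a in ia | j =ᶠ b in jb | i =ᶠ b in ib | j =ᶠ a in ja
  ... | true | true | _    | _    = inj₁ (does-true⇒ (i ≟ a) ia , does-true⇒ (j ≟ b) jb)
  ... | true | false | true | true = inj₂ (does-true⇒ (i ≟ b) ib , does-true⇒ (j ≟ a) ja)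
  ... | false | _   | true | true = inj₂ (does-true⇒ (i ≟ b) ib , does-true⇒ (j ≟ a) ja)

  edge-self : ∀ a b → edge a b a b ≡ true
  edge-self a b rewrite =ᶠ-refl a | =ᶠ-refl b = refl

  edge-symmetric : ∀ a b → Symmetric (edge a b)
  edge-symmetric a b i j =
    trans (cong₂ _∨_ (∧-comm (i =ᶠ a) _) (∧-comm (i =ᶠ b) _)) (∨-comm (j =ᶠ b ∧ i =ᶠ a) _)

  edge-irreflexive : ∀ {a b} → a ≢ b → Irreflexive (edge a b)
  edge-irreflexive {a} {b} a≢b i = ¬-not λ e → a≢b (endpoints-equal (edge-sound e))
    where
    endpoints-equal : (i ≡ a × i ≡ b) ⊎ (i ≡ b × i ≡ a) → a ≡ b
    endpoints-equal (inj₁ (refl , refl)) = refl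
    endpoints-equal (inj₂ (refl , refl)) = refl

  edge-value : ∀ {G : Graph n} {a b i j} → Symmetric G → edge a b i j ≡ true → G i j ≡ G a b
  edge-value {a = a} {b} {i} {j} sym-G e with edge-sound {a} {b} {i} {j} e
  ... | inj₁ (refl , refl) = refl
  ... | inj₂ (refl , refl) = sym-G _ _

  edges-disjoint : ∀ {a b c e} → a ≢ c → a ≢ e → Disjoint (edge a b) (edge c e)
  edges-disjoint {a} {b} {c} {e} a≢c a≢e i j ab ce
    with edge-sound {a} {b} {i} {j} ab | edge-sound {c} {e} {i} {j} ce
  ... | inj₁ (refl , refl) | inj₁ (refl , refl) = a≢c refl
  ... | inj₁ (refl , refl) | inj₂ (refl , refl) = a≢e refl
  ... | inj₂ (refl , refl) | inj₁ (refl , refl) = a≢e refl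
  ... | inj₂ (refl , refl) | inj₂ (refl , refl) = a≢c refl

  ∪-disjoint : ∀ {A B G : Graph n} → Disjoint A G → Disjoint B G → Disjoint (A ∪ B) G
  ∪-disjoint {A} A∩G B∩G i j AB G-ij with A i j in Aij
  ... | true  = A∩G i j Aij G-ij
  ... | false = B∩G i j AB G-ij

  ∪-⊆ : ∀ {A B G : Graph n} → A ⊆ G → B ⊆ G → A ∪ B ⊆ G
  ∪-⊆ {A} A⊆G B⊆G i j AB with A i j in Aij
  ... | true  = A⊆G i j Aij
  ... | false = B⊆G i j AB

  edge-⊆ : ∀ {G : Graph n} {a b} → Symmetric G → G a b ≡ true → edge a b ⊆ G
  edge-⊆ sym-G Gab i j e = trans (edge-value sym-G e) Gab

  edge-disjoint : ∀ {G : Graph n} {a b} → Symmetric G → G a b ≡ false → Disjoint (edge a b) G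
  edge-disjoint sym-G Gab i j e Gij with trans (sym Gij) (trans (edge-value sym-G e) Gab)
  ... | ()

  deg-∪ : ∀ {A B : Graph n} → Disjoint A B → ∀ i → deg (A ∪ B) i ≡ deg A i + deg B i
  deg-∪ {A} {B} A∩B i =
    trans (∑-cong (allFin n) λ j → ⟦∨⟧-disjoint (A i j) (B i j) (A∩B i j)) (∑-+ (allFin n) _ _)

  deg-edge : ∀ {a b} → a ≢ b → ∀ i → deg (edge a b) i ≡ ⟦ i =ᶠ a ⟧ + ⟦ i =ᶠ b ⟧
  deg-edge {a} {b} a≢b i = begin
    ∑[ j ∈ allFin n ] ⟦ (i =ᶠ a ∧ j =ᶠ b) ∨ (i =ᶠ b ∧ j =ᶠ a) ⟧
      ≡⟨ ∑-cong (allFin n) (λ j → ⟦∨⟧-disjoint (i =ᶠ a ∧ j =ᶠ b) _ (not-both j)) ⟩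
    ∑[ j ∈ allFin n ] (⟦ i =ᶠ a ∧ j =ᶠ b ⟧ + ⟦ i =ᶠ b ∧ j =ᶠ a ⟧)
      ≡⟨ ∑-+ (allFin n) _ _ ⟩
    ∑[ j ∈ allFin n ] ⟦ i =ᶠ a ∧ j =ᶠ b ⟧ + ∑[ j ∈ allFin n ] ⟦ i =ᶠ b ∧ j =ᶠ a ⟧
      ≡⟨ cong₂ _+_ (point (i =ᶠ a) b) (point (i =ᶠ b) a) ⟩
    ⟦ i =ᶠ a ⟧ + ⟦ i =ᶠ b ⟧ ∎
    where
    open ≡-Reasoning
    not-both : ∀ j → (i =ᶠ a ∧ j =ᶠ b) ≡ true → (i =ᶠ b ∧ j =ᶠ a) ≡ true → ⊥
    not-both j p q = a≢b (trans (sym (does-true⇒ (i ≟ a) (proj₁ (∧-true⁻ p))))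
                                (does-true⇒ (i ≟ b) (proj₁ (∧-true⁻ q))))
    point : ∀ s c → ∑[ j ∈ allFin n ] ⟦ s ∧ j =ᶠ c ⟧ ≡ ⟦ s ⟧
    point s c = begin
      ∑[ j ∈ allFin n ] ⟦ s ∧ j =ᶠ c ⟧          ≡⟨ ∑-cong (allFin n) (λ j → ⟦∧⟧ s (j =ᶠ c)) ⟩
      ∑[ j ∈ allFin n ] (⟦ s ⟧ * ⟦ j =ᶠ c ⟧)    ≡⟨ ∑-*ˡ (allFin n) ⟦ s ⟧ _ ⟩
      ⟦ s ⟧ * ∑[ j ∈ allFin n ] ⟦ j =ᶠ c ⟧      ≡⟨ cong (⟦ s ⟧ *_) (∑-allFin-=ᶠ n c) ⟩
      ⟦ s ⟧ * 1                                  ≡⟨ *-identityʳ _ ⟩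
      ⟦ s ⟧                                      ∎

  switch : Graph n → Graph n → Graph n → Graph n
  switch A R G i j = A i j ∨ (not (R i j) ∧ G i j)

  switch-cong : ∀ A R {G H : Graph n} → G ≐ H → switch A R G ≐ switch A R H
  switch-cong A R G≐H i j = cong (λ g → A i j ∨ (not (R i j) ∧ g)) (G≐H i j)

  added-⊆-switch : ∀ A R (G : Graph n) → A ⊆ switch A R G
  added-⊆-switch A R G i j Aij rewrite Aij = refl

  switch-symmetric : ∀ {A R G : Graph n} → Symmetric A → Symmetric R → Symmetric G →
                     Symmetric (switch A R G)
  switch-symmetric sym-A sym-R sym-G i j rewrite sym-A i j | sym-R i j | sym-G i j = refl

  switch-irreflexive : ∀ {A R G : Graph n} → Irreflexive A → Irreflexive G →
                       Irreflexive (switch A R G)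
  switch-irreflexive {R = R} irr-A irr-G i rewrite irr-A i | irr-G i = ∧-zeroʳ (not (R i i))

  switch-⊇ : ∀ {A R G S : Graph n} → S ⊆ G → Disjoint S R → S ⊆ switch A R G
  switch-⊇ {A} {R} S⊆G S∩R i j Sij with A i j
  ... | true  = refl
  ... | false rewrite ¬-not (S∩R i j Sij) = S⊆G i j Sij

  module _ {A R G : Graph n} (A∩G : Disjoint A G) (R⊆G : R ⊆ G) where

    private
      switch-count : ∀ a r g → (a ≡ true → g ≡ true → ⊥) → (r ≡ true → g ≡ true) →
                     ⟦ a ∨ (not r ∧ g) ⟧ + ⟦ r ⟧ ≡ ⟦ g ⟧ + ⟦ a ⟧
      switch-count true  true  g     a∩g r⊆g = ⊥-elim (a∩g refl (r⊆g refl))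
      switch-count true  false false a∩g r⊆g = refl
      switch-count true  false true  a∩g r⊆g = ⊥-elim (a∩g refl refl)
      switch-count false true  g     a∩g r⊆g rewrite r⊆g refl = refl
      switch-count false false g     a∩g r⊆g = refl

      unswitch : ∀ a r g → (a ≡ true → g ≡ true → ⊥) → (r ≡ true → g ≡ true) →
                 r ∨ (not a ∧ (a ∨ (not r ∧ g))) ≡ g
      unswitch true  r     true  a∩g r⊆g = ⊥-elim (a∩g refl refl)
      unswitch true  true  false a∩g r⊆g with r⊆g refl
      ... | ()
      unswitch true  false false a∩g r⊆g = refl
      unswitch false true  g     a∩g r⊆g = sym (r⊆g refl)
      unswitch false false g     a∩g r⊆g = refl

    deg-switch : ∀ i → deg (switch A R G) i + deg R i ≡ deg G i + deg A i
    deg-switch i = begin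
      deg (switch A R G) i + deg R i                 ≡⟨ ∑-+ (allFin n) _ _ ⟨
      ∑[ j ∈ allFin n ] (⟦ switch A R G i j ⟧ + ⟦ R i j ⟧)
        ≡⟨ ∑-cong (allFin n) (λ j → switch-count (A i j) (R i j) (G i j) (A∩G i j) (R⊆G i j)) ⟩
      ∑[ j ∈ allFin n ] (⟦ G i j ⟧ + ⟦ A i j ⟧)     ≡⟨ ∑-+ (allFin n) _ _ ⟩
      deg G i + deg A i                              ∎
      where open ≡-Reasoning

    switch-inverse : switch R A (switch A R G) ≐ G
    switch-inverse i j = unswitch (A i j) (R i j) (G i j) (A∩G i j) (R⊆G i j)

  switchAt : Fin n → Fin n → Fin n → Fin n → Graph n → Graph n
  switchAt v w x y = switch (edge v x ∪ edge w y) (edge v w ∪ edge x y)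

  unswitchAt : Fin n → Fin n → Fin n → Fin n → Graph n → Graph n
  unswitchAt v w x y = switch (edge v w ∪ edge x y) (edge v x ∪ edge w y)

  deg-added≡deg-removed : ∀ {v w x y} → v ≢ w → v ≢ x → v ≢ y → w ≢ y → x ≢ y →
    ∀ i → deg (edge v x ∪ edge w y) i ≡ deg (edge v w ∪ edge x y) i
  deg-added≡deg-removed {v} {w} {x} {y} v≢w v≢x v≢y w≢y x≢y i = begin
    deg (edge v x ∪ edge w y) i
      ≡⟨ deg-∪ (edges-disjoint v≢w v≢y) i ⟩
    deg (edge v x) i + deg (edge w y) i
      ≡⟨ cong₂ _+_ (deg-edge v≢x i) (deg-edge w≢y i) ⟩
    (⟦ i =ᶠ v ⟧ + ⟦ i =ᶠ x ⟧) + (⟦ i =ᶠ w ⟧ + ⟦ i =ᶠ y ⟧)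
      ≡⟨ +-interchange ⟦ i =ᶠ v ⟧ _ _ _ ⟩
    (⟦ i =ᶠ v ⟧ + ⟦ i =ᶠ w ⟧) + (⟦ i =ᶠ x ⟧ + ⟦ i =ᶠ y ⟧)
      ≡⟨ cong₂ _+_ (deg-edge v≢w i) (deg-edge x≢y i) ⟨
    deg (edge v w) i + deg (edge x y) i
      ≡⟨ deg-∪ (edges-disjoint v≢x v≢y) i ⟨
    deg (edge v w ∪ edge x y) i ∎
    where open ≡-Reasoning

module _ {n : ℕ} (S : Graph n) (v w : Fin n) where

  blocked-at : Graph n → Fin n → Fin n → Bool
  blocked-at G a x = G a x ∨ (x =ᶠ v ∨ x =ᶠ w)

  switchable : Graph n → Fin n → Fin n → Bool
  switchable G x y = G x y ∧ not (blocked-at G v x ∨ (blocked-at G w y ∨ S x y))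

  record Switchable (G : Graph n) (x y : Fin n) : Set where
    field
      Gxy : G x y ≡ true
      ¬Gvx : G v x ≡ false
      ¬Gwy : G w y ≡ false
      ¬Sxy : S x y ≡ false
      x≢v : x ≢ v
      y≢v : y ≢ v
      y≢w : y ≢ w

  switchable-sound : ∀ {G x y} → switchable G x y ≡ true → Switchable G x y
  switchable-sound {G} {x} {y} e with ∧-true⁻ e
  ... | Gxy , free with ∨-false⁻ (not-injective free)
  ... | at-v , rest with ∨-false⁻ at-v | ∨-false⁻ rest
  ... | Gvx , x∉vw | at-w , Sxy with ∨-false⁻ x∉vw | ∨-false⁻ at-w
  ... | x=v , _ | Gwy , y∉vw with ∨-false⁻ y∉vw
  ... | y=v , y=w = record
    { Gxy = Gxy ; ¬Gvx = Gvx ; ¬Gwy = Gwy ; ¬Sxy = Sxy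
    ; x≢v = does-false⇒ (x ≟ v) x=v
    ; y≢v = does-false⇒ (y ≟ v) y=v ; y≢w = does-false⇒ (y ≟ w) y=w
    }

  module Switching {d} {G : Graph n} {x y} (sym-S : Symmetric S) (S-vw : S v w ≡ false)
           (RC : RegularContaining d S G) (G-vw : G v w ≡ true) (SW : Switchable G x y) where

    open RegularContaining RC
    open Switchable SW

    private
      added removed : Graph n
      added   = edge v x ∪ edge w y
      removed = edge v w ∪ edge x y

      loop-free : ∀ {a b} → G a b ≡ true → a ≢ b
      loop-free {a} Gab refl with trans (sym Gab) (irreflexive a)
      ... | ()

      added∩G : Disjoint added G
      added∩G = ∪-disjoint (edge-disjoint symmetric ¬Gvx) (edge-disjoint symmetric ¬Gwy)

      removed⊆G : removed ⊆ G
      removed⊆G = ∪-⊆ (edge-⊆ symmetric G-vw) (edge-⊆ symmetric Gxy)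

      S∩removed : Disjoint S removed
      S∩removed = Disjoint-sym (∪-disjoint (edge-disjoint sym-S S-vw) (edge-disjoint sym-S ¬Sxy))

      balanced : ∀ i → deg added i ≡ deg removed i
      balanced = deg-added≡deg-removed (loop-free G-vw) (x≢v ∘ sym) (y≢v ∘ sym) (y≢w ∘ sym) (loop-free Gxy)

    switchAt-regularContaining : RegularContaining d S (switchAt v w x y G)
    switchAt-regularContaining = record
      { symmetric   = switch-symmetric (∪-symmetric (edge-symmetric v x) (edge-symmetric w y))
                                       (∪-symmetric (edge-symmetric v w) (edge-symmetric x y)) symmetric
      ; irreflexive = switch-irreflexive {A = added} {R = removed} {G = G}
                        (∪-irreflexive {A = edge v x} {B = edge w y} (edge-irreflexive (x≢v ∘ sym))
                                                                     (edge-irreflexive (y≢w ∘ sym)))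
                        irreflexive
      ; regular     = λ i → +-cancelʳ-≡ _ _ _ (trans (deg-switch added∩G removed⊆G i)
                              (cong₂ _+_ (regular i) (balanced i)))
      ; contains-S  = switch-⊇ contains-S S∩removed
      }

    switchAt-vx : switchAt v w x y G v x ≡ true
    switchAt-vx = added-⊆-switch added removed G v x (cong (_∨ edge w y v x) (edge-self v x))

    switchAt-wy : switchAt v w x y G w y ≡ true
    switchAt-wy =
      added-⊆-switch added removed G w y (trans (cong (edge v x w y ∨_) (edge-self w y)) (∨-zeroʳ _))

    unswitchAt-switchAt : unswitchAt v w x y (switchAt v w x y G) ≐ G
    unswitchAt-switchAt = switch-inverse added∩G removed⊆G

8*e≤n : ∀ {n} e → 64 ≤ n → e * e ≤ n → 8 * e ≤ n
8*e≤n e 64≤n e²≤n with ≤-total e 8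
... | inj₁ e≤8 = ≤-trans (*-monoʳ-≤ 8 e≤8) 64≤n
... | inj₂ 8≤e = ≤-trans (≤-trans (≤-reflexive (*-comm 8 e)) (*-monoʳ-≤ e 8≤e)) e²≤n

half-absorbed : ∀ {n V X} → n ≤ V + X → 2 * X ≤ n → n ≤ 2 * V
half-absorbed {n} {V} {X} n≤V+X 2X≤n = +-cancelʳ-≤ n n (2 * V) (begin
  n + n         ≡⟨ cong (n +_) (*-identityˡ n) ⟨
  2 * n         ≤⟨ *-monoʳ-≤ 2 n≤V+X ⟩
  2 * (V + X)   ≡⟨ *-distribˡ-+ 2 V X ⟩
  2 * V + 2 * X ≤⟨ +-monoʳ-≤ (2 * V) 2X≤n ⟩
  2 * V + n     ∎)
  where open ≤-Reasoning

switchings-dominate : ∀ {n V K e} → 64 + 8 * K ≤ n → e * e ≤ n →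
                      n ≤ V + (K + (K + (e + e))) → n ≤ 2 * V
switchings-dominate {n} {V} {K} {e} N≤n e²≤n n≤V+X =
  half-absorbed {n} {V} {K + (K + (e + e))} n≤V+X (*-cancelˡ-≤ 2 (begin
    2 * (2 * (K + (K + (e + e)))) ≡⟨ solve 2 (λ k e → con 2 :* (con 2 :* (k :+ (k :+ (e :+ e))))
                                                      := con 8 :* k :+ con 8 :* e) refl K e ⟩
    8 * K + 8 * e                 ≤⟨ +-mono-≤ (≤-trans (m≤n+m (8 * K) 64) N≤n)
                                              (8*e≤n e (≤-trans (m≤m+n 64 _) N≤n) e²≤n) ⟩
    n + n                         ≡⟨ cong (n +_) (*-identityˡ n) ⟨
    2 * n                         ∎))
  where
  open ≤-Reasoning
  open +-*-Solver

-- Counting switchings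

module _ {n : ℕ} where

  ∑²-weighted-rows : ∀ {G : Graph n} {d} → (∀ i → deg G i ≡ d) →
                     ∀ (f : Fin n → ℕ) → ∑²[ x , y ] (f x * ⟦ G x y ⟧) ≡ ∑ (allFin n) f * d
  ∑²-weighted-rows regular f =
    trans (∑-cong (allFin n) λ x → trans (∑-*ˡ (allFin n) (f x) _) (cong (f x *_) (regular x)))
          (∑-*ʳ (allFin n) _ f)

  ∑²-weighted-columns : ∀ {G : Graph n} {d} → Symmetric G → (∀ i → deg G i ≡ d) →
                        ∀ (f : Fin n → ℕ) → ∑²[ x , y ] (f y * ⟦ G x y ⟧) ≡ ∑ (allFin n) f * d
  ∑²-weighted-columns {G} {d} sym-G regular f = begin
    ∑²[ x , y ] (f y * ⟦ G x y ⟧) ≡⟨ ∑²-transpose (λ x y → f y * ⟦ G x y ⟧) ⟩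
    ∑²[ x , y ] (f x * ⟦ G y x ⟧) ≡⟨ ∑-cong (allFin n) (λ x → ∑-cong (allFin n) λ y →
                                       cong (λ b → f x * ⟦ b ⟧) (sym-G y x)) ⟩
    ∑²[ x , y ] (f x * ⟦ G x y ⟧) ≡⟨ ∑²-weighted-rows regular f ⟩
    ∑ (allFin n) f * d            ∎
    where open ≡-Reasoning

  edges-counted-twice : ∀ {S : Graph n} → Symmetric S → Irreflexive S →
                        ∑²[ x , y ] ⟦ S x y ⟧ ≤ edgeCount S + edgeCount S
  edges-counted-twice {S} sym-S irr-S = begin
    ∑²[ x , y ] ⟦ S x y ⟧
      ≤⟨ ∑²-mono one-orientation ⟩
    ∑²[ x , y ] (⟦ x < y ∧ S x y ⟧ + ⟦ y < x ∧ S y x ⟧)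
      ≡⟨ ∑²-+ (λ x y → ⟦ x < y ∧ S x y ⟧) (λ x y → ⟦ y < x ∧ S y x ⟧) ⟩
    ∑²[ x , y ] ⟦ x < y ∧ S x y ⟧ + ∑²[ x , y ] ⟦ y < x ∧ S y x ⟧
      ≡⟨ cong (∑²[ x , y ] ⟦ x < y ∧ S x y ⟧ +_) (∑²-transpose (λ x y → ⟦ x < y ∧ S x y ⟧)) ⟨
    ∑²[ x , y ] ⟦ x < y ∧ S x y ⟧ + ∑²[ x , y ] ⟦ x < y ∧ S x y ⟧
      ≡⟨ cong₂ _+_ edgeCount≡ edgeCount≡ ⟩
    edgeCount S + edgeCount S ∎
    where
    open ≤-Reasoning
    _<_ : Fin n → Fin n → Bool
    i < j = toℕ i <ᵇ toℕ j
    edgeCount≡ : ∑²[ x , y ] ⟦ x < y ∧ S x y ⟧ ≡ edgeCount S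
    edgeCount≡ = sym (sum-concatMap _ (allFin n))
    <ᵇ-true : ∀ {i j} → toℕ i ℕ.< toℕ j → i < j ≡ true
    <ᵇ-true i<j = Equivalence.to T-≡ (<⇒<ᵇ i<j)
    one-orientation : ∀ i j → ⟦ S i j ⟧ ≤ ⟦ i < j ∧ S i j ⟧ + ⟦ j < i ∧ S j i ⟧
    one-orientation i j with S i j in Sij | <-cmp (toℕ i) (toℕ j)
    ... | false | _ = z≤n
    ... | true | tri< i<j _ _ rewrite <ᵇ-true i<j = s≤s z≤n
    ... | true | tri> _ _ j<i rewrite <ᵇ-true j<i | sym-S j i | Sij = m≤n+m 1 _
    ... | true | tri≈ _ i≡j _ with toℕ-injective i≡j
    ...   | refl with trans (sym Sij) (irr-S i)
    ...     | ()

module _ {n : ℕ} (d : ℕ) (S : Graph n) (v w : Fin n) where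

  private
    Gs : List (Graph n)
    Gs = allGraphs n

    with-vw : Graph n → Bool
    with-vw G = regContaining d S G ∧ G v w

  switchCount : Graph n → ℕ
  switchCount G = ∑²[ x , y ] ⟦ switchable S v w G x y ⟧

  blocked-at-count : ∀ (G : Graph n) a → ∑[ x ∈ allFin n ] ⟦ blocked-at S v w G a x ⟧ ≤ deg G a + 2
  blocked-at-count G a = begin
    ∑[ x ∈ allFin n ] ⟦ G a x ∨ (x =ᶠ v ∨ x =ᶠ w) ⟧
      ≤⟨ ∑-mono (allFin n) (λ x → ≤-trans (⟦∨⟧-≤ (G a x) _) (+-monoʳ-≤ ⟦ G a x ⟧ (⟦∨⟧-≤ (x =ᶠ v) _))) ⟩
    ∑[ x ∈ allFin n ] (⟦ G a x ⟧ + (⟦ x =ᶠ v ⟧ + ⟦ x =ᶠ w ⟧))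
      ≡⟨ trans (∑-+ (allFin n) _ _) (cong (deg G a +_) (∑-+ (allFin n) _ _)) ⟩
    deg G a + (∑[ x ∈ allFin n ] ⟦ x =ᶠ v ⟧ + ∑[ x ∈ allFin n ] ⟦ x =ᶠ w ⟧)
      ≡⟨ cong (deg G a +_) (cong₂ _+_ (∑-allFin-=ᶠ n v) (∑-allFin-=ᶠ n w)) ⟩
    deg G a + 2 ∎
    where open ≤-Reasoning

  switchCount-lower-bound : ∀ {G} → Symmetric S → Irreflexive S → RegularContaining d S G →
    n * d ≤ switchCount G + ((d + 2) * d + ((d + 2) * d + (edgeCount S + edgeCount S)))
  switchCount-lower-bound {G} sym-S irr-S RC = begin
    n * d
      ≡⟨ trans (∑-cong (allFin n) regular) (∑-allFin-const n d) ⟨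
    ∑²[ x , y ] ⟦ G x y ⟧
      ≤⟨ ∑²-mono (λ x y → kept-or-blocked (G x y) (blocked-v x) (blocked-w y) (S x y)) ⟩
    ∑²[ x , y ] (⟦ switchable S v w G x y ⟧
                  + (⟦ blocked-v x ⟧ * ⟦ G x y ⟧ + (⟦ blocked-w y ⟧ * ⟦ G x y ⟧ + ⟦ S x y ⟧)))
      ≡⟨ ∑²-+₄ _ _ _ _ ⟩
    switchCount G + (∑²[ x , y ] (⟦ blocked-v x ⟧ * ⟦ G x y ⟧)
                     + (∑²[ x , y ] (⟦ blocked-w y ⟧ * ⟦ G x y ⟧) + ∑²[ x , y ] ⟦ S x y ⟧))
      ≤⟨ +-monoʳ-≤ (switchCount G)
           (+-mono-≤ near-v (+-mono-≤ near-w (edges-counted-twice sym-S irr-S))) ⟩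
    switchCount G + ((d + 2) * d + ((d + 2) * d + (edgeCount S + edgeCount S))) ∎
    where
    open ≤-Reasoning
    open RegularContaining RC
    ∑²-+₄ : ∀ (f g h k : Fin n → Fin n → ℕ) →
            ∑²[ x , y ] (f x y + (g x y + (h x y + k x y))) ≡ ∑² f + (∑² g + (∑² h + ∑² k))
    ∑²-+₄ f g h k =
      trans (∑²-+ f _) (cong (∑² f +_) (trans (∑²-+ g _) (cong (∑² g +_) (∑²-+ h k))))
    blocked-v blocked-w : Fin n → Bool
    blocked-v = blocked-at S v w G v
    blocked-w = blocked-at S v w G w
    kept-or-blocked : ∀ g p q s →
                      ⟦ g ⟧ ≤ ⟦ g ∧ not (p ∨ (q ∨ s)) ⟧ + (⟦ p ⟧ * ⟦ g ⟧ + (⟦ q ⟧ * ⟦ g ⟧ + ⟦ s ⟧))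
    kept-or-blocked false p     q     s     = z≤n
    kept-or-blocked true  true  q     s     = s≤s z≤n
    kept-or-blocked true  false true  s     = s≤s z≤n
    kept-or-blocked true  false false true  = s≤s z≤n
    kept-or-blocked true  false false false = s≤s z≤n
    near : ∀ a → ∑[ x ∈ allFin n ] ⟦ blocked-at S v w G a x ⟧ * d ≤ (d + 2) * d
    near a = *-monoˡ-≤ d (≤-trans (blocked-at-count G a) (≤-reflexive (cong (_+ 2) (regular a))))
    near-v : ∑²[ x , y ] (⟦ blocked-v x ⟧ * ⟦ G x y ⟧) ≤ (d + 2) * d
    near-v = ≤-trans (≤-reflexive (∑²-weighted-rows regular (λ x → ⟦ blocked-v x ⟧))) (near v)
    near-w : ∑²[ x , y ] (⟦ blocked-w y ⟧ * ⟦ G x y ⟧) ≤ (d + 2) * d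
    near-w = ≤-trans (≤-reflexive (∑²-weighted-columns symmetric regular (λ y → ⟦ blocked-w y ⟧))) (near w)

  many-switchings : Symmetric S → Irreflexive S → 64 + 8 * ((d + 2) * d) ≤ n →
                    edgeCount S * edgeCount S ≤ n → ∀ G → with-vw G ≡ true → n ≤ 2 * switchCount G
  many-switchings sym-S irr-S N≤n e²≤n G e with ∧-true⁻ {regContaining d S G} e
  ... | rc , G-vw = switchings-dominate {n} {switchCount G} {(d + 2) * d} {edgeCount S} N≤n e²≤n (begin
    n                      ≡⟨ *-identityʳ n ⟨
    n * 1                  ≤⟨ *-monoʳ-≤ n 1≤d ⟩
    n * d                  ≤⟨ switchCount-lower-bound sym-S irr-S RC ⟩
    switchCount G + _      ∎)
    where
    open ≤-Reasoning
    RC : RegularContaining d S G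
    RC = regContaining-sound rc
    open RegularContaining RC
    1≤d : 1 ≤ d
    1≤d = begin
      ⟦ true ⟧   ≡⟨ cong ⟦_⟧ G-vw ⟨
      ⟦ G v w ⟧  ≤⟨ term-≤-∑ (allFin n) (λ j → ⟦ G v j ⟧) (∈-allFin w) ⟩
      deg G v    ≡⟨ regular v ⟩
      d          ∎

  switchings-into : Symmetric S → S v w ≡ false → ∀ x y →
    ∑[ G ∈ Gs ] ⟦ with-vw G ∧ switchable S v w G x y ⟧
      ≤ ∑[ H ∈ Gs ] ⟦ regContaining d S H ∧ (H v x ∧ H w y) ⟧
  switchings-into sym-S S-vw x y =
    count-≤-via-injection Gs Gs (allGraphs-enumerates n) (allGraphs-enumerates n)
      (λ G → with-vw G ∧ switchable S v w G x y) (λ H → regContaining d S H ∧ (H v x ∧ H w y))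
      (switchAt v w x y) (unswitchAt v w x y) injective
    where
    injective : ∀ G H → with-vw G ∧ switchable S v w G x y ≡ true → H ==ᴳ switchAt v w x y G ≡ true →
                regContaining d S H ∧ (H v x ∧ H w y) ≡ true × G ==ᴳ unswitchAt v w x y H ≡ true
    injective G H e H= with ∧-true⁻ {with-vw G} e
    ... | vw∈G , sw with ∧-true⁻ {regContaining d S G} vw∈G
    ... | rc , G-vw =
      cong₂ _∧_ (regContaining-complete (RegularContaining-resp H≐′ switchAt-regularContaining))
                (cong₂ _∧_ (trans (H≐ v x) switchAt-vx) (trans (H≐ w y) switchAt-wy)) ,
      ==ᴳ-complete (λ i j → trans (sym (unswitchAt-switchAt i j))
                                  (switch-cong (edge v w ∪ edge x y) (edge v x ∪ edge w y) H≐′ i j))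
      where
      open Switching S v w sym-S S-vw (regContaining-sound rc) G-vw (switchable-sound S v w sw)
      H≐ : H ≐ switchAt v w x y G
      H≐ = ==ᴳ-sound H=
      H≐′ : switchAt v w x y G ≐ H
      H≐′ i j = sym (H≐ i j)

  total-switchings : Symmetric S → S v w ≡ false →
    ∑[ G ∈ Gs ] (⟦ with-vw G ⟧ * switchCount G) ≤ ∑[ H ∈ Gs ] ⟦ regContaining d S H ⟧ * (d * d)
  total-switchings sym-S S-vw = begin
    ∑[ G ∈ Gs ] (⟦ with-vw G ⟧ * switchCount G)
      ≡⟨ ∑-cong Gs (λ G → ∑²-⟦∧⟧ (with-vw G) (switchable S v w G)) ⟨
    ∑[ G ∈ Gs ] ∑²[ x , y ] ⟦ with-vw G ∧ switchable S v w G x y ⟧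
      ≡⟨ ∑-∑²-swap Gs (λ G x y → ⟦ with-vw G ∧ switchable S v w G x y ⟧) ⟩
    ∑²[ x , y ] ∑[ G ∈ Gs ] ⟦ with-vw G ∧ switchable S v w G x y ⟧
      ≤⟨ ∑²-mono (switchings-into sym-S S-vw) ⟩
    ∑²[ x , y ] ∑[ H ∈ Gs ] ⟦ regContaining d S H ∧ (H v x ∧ H w y) ⟧
      ≡⟨ ∑-∑²-swap Gs (λ H x y → ⟦ regContaining d S H ∧ (H v x ∧ H w y) ⟧) ⟨
    ∑[ H ∈ Gs ] ∑²[ x , y ] ⟦ regContaining d S H ∧ (H v x ∧ H w y) ⟧
      ≡⟨ ∑-cong Gs (λ H → ∑²-⟦∧⟧ (regContaining d S H) (λ x y → H v x ∧ H w y)) ⟩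
    ∑[ H ∈ Gs ] (⟦ regContaining d S H ⟧ * ∑²[ x , y ] ⟦ H v x ∧ H w y ⟧)
      ≡⟨ ∑-cong Gs degree-product ⟩
    ∑[ H ∈ Gs ] (⟦ regContaining d S H ⟧ * (d * d))
      ≡⟨ ∑-*ʳ Gs (d * d) _ ⟩
    ∑[ H ∈ Gs ] ⟦ regContaining d S H ⟧ * (d * d) ∎
    where
    open ≤-Reasoning
    degree-product : ∀ H → ⟦ regContaining d S H ⟧ * ∑²[ x , y ] ⟦ H v x ∧ H w y ⟧
                           ≡ ⟦ regContaining d S H ⟧ * (d * d)
    degree-product H with regContaining d S H in rc
    ... | false = refl
    ... | true  = cong (1 *_) (begin-equality
      ∑²[ x , y ] ⟦ H v x ∧ H w y ⟧
        ≡⟨ ∑-cong (allFin n) (λ x → ∑-cong (allFin n) λ y → ⟦∧⟧ (H v x) (H w y)) ⟩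
      ∑²[ x , y ] (⟦ H v x ⟧ * ⟦ H w y ⟧) ≡⟨ ∑-*-∑ (allFin n) (allFin n) _ _ ⟩
      deg H v * deg H w                   ≡⟨ cong₂ _*_ (regular v) (regular w) ⟩
      d * d                               ∎)
      where open RegularContaining (regContaining-sound {d = d} {S} {H} rc)

  large-n-bound : Symmetric S → S v w ≡ false → (∀ G → with-vw G ≡ true → n ≤ 2 * switchCount G) →
    n * ∑[ G ∈ Gs ] ⟦ with-vw G ⟧ ≤ 2 * (d * d) * ∑[ G ∈ Gs ] ⟦ regContaining d S G ⟧
  large-n-bound sym-S S-vw many = begin
    n * ∑[ G ∈ Gs ] ⟦ with-vw G ⟧                      ≡⟨ ∑-*ˡ Gs n _ ⟨
    ∑[ G ∈ Gs ] (n * ⟦ with-vw G ⟧)                    ≤⟨ ∑-mono Gs (λ G → weighted (with-vw G) (many G)) ⟩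
    ∑[ G ∈ Gs ] (2 * (⟦ with-vw G ⟧ * switchCount G))  ≡⟨ ∑-*ˡ Gs 2 _ ⟩
    2 * ∑[ G ∈ Gs ] (⟦ with-vw G ⟧ * switchCount G)    ≤⟨ *-monoʳ-≤ 2 (total-switchings sym-S S-vw) ⟩
    2 * (∑[ H ∈ Gs ] ⟦ regContaining d S H ⟧ * (d * d))
      ≡⟨ trans (*-assoc 2 (d * d) _) (cong (2 *_) (*-comm (d * d) _)) ⟨
    2 * (d * d) * ∑[ H ∈ Gs ] ⟦ regContaining d S H ⟧ ∎
    where
    open ≤-Reasoning
    weighted : ∀ {V} b → (b ≡ true → n ≤ 2 * V) → n * ⟦ b ⟧ ≤ 2 * (⟦ b ⟧ * V)
    weighted {V} true  h = subst₂ _≤_ (sym (*-identityʳ n)) (cong (2 *_) (sym (+-identityʳ V))) (h refl)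
    weighted     false h = ≤-reflexive (*-zeroʳ n)

lemma4p6 : (d : ℕ) → ∃ λ (c : ℕ) →
    (n : ℕ) (S : Graph n) (v w : Fin n) →
    isSimple S ≡ true →
    edgeCount S * edgeCount S ≤ n →
    S v w ≡ false →
    n * countRegContainingEdge n d S v w ≤ c * countRegContaining n d S
lemma4p6 d = N + 2 * (d * d) , bound
  where
  N : ℕ
  N = 64 + 8 * ((d + 2) * d)
  bound : (n : ℕ) (S : Graph n) (v w : Fin n) → isSimple S ≡ true → edgeCount S * edgeCount S ≤ n →
          S v w ≡ false →
          n * countRegContainingEdge n d S v w ≤ (N + 2 * (d * d)) * countRegContaining n d S
  bound n S v w S-simple e²≤n S-vw = begin
    n * countRegContainingEdge n d S v w          ≡⟨ cong (n *_) (countRegContainingEdge≡ d S v w) ⟩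
    n * with-vw                                   ≤⟨ by-size (≤-total n N) ⟩
    (N + 2 * (d * d)) * total                     ≡⟨ cong ((N + 2 * (d * d)) *_) (countRegContaining≡ d S) ⟨
    (N + 2 * (d * d)) * countRegContaining n d S  ∎
    where
    open ≤-Reasoning
    with-vw total : ℕ
    with-vw = ∑[ G ∈ allGraphs n ] ⟦ regContaining d S G ∧ G v w ⟧
    total   = ∑[ G ∈ allGraphs n ] ⟦ regContaining d S G ⟧
    sym-S : Symmetric S
    sym-S = proj₁ (isSimple-sound S-simple)
    irr-S : Irreflexive S
    irr-S = proj₂ (isSimple-sound {G = S} S-simple)
    by-size : n ≤ N ⊎ N ≤ n → n * with-vw ≤ (N + 2 * (d * d)) * total
    by-size (inj₁ n≤N) =
      *-mono-≤ (≤-trans n≤N (m≤m+n N _)) (∑-mono (allGraphs n) λ G → ⟦∧⟧-≤ˡ (regContaining d S G) (G v w))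
    by-size (inj₂ N≤n) =
      ≤-trans (large-n-bound d S v w sym-S S-vw (many-switchings d S v w sym-S irr-S N≤n e²≤n))
              (*-monoˡ-≤ total (m≤n+m _ N))
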